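{- Over the class $\mathsf{Lin}$ of all linear orders, $FO+S$ defines $r$ for each of the following pairs $(r,S)$: $r=\mathrm{ii}_{34}$: $S\in\{\{\mathrm{ii}_{14},\mathrm{ii}_{24}\},\{\mathrm{ii}_{03},\mathrm{ii}_{24}\},\{\mathrm{ii}_{14},\mathrm{ii}_{03}\},\{\mathrm{ii}_{14},\mathrm{ii}_{44}\},\{\mathrm{ii}_{03},\mathrm{ii}_{44}\},\{\mathrm{ii}_{14},\mathrm{ii}_{04}\},\{\mathrm{ii}_{03},\mathrm{ii}_{04}\}\}$; $r=\mathrm{ii}_{14}$: $S\in\{\{\mathrm{ii}_{34}\},\{\mathrm{ii}_{03},\mathrm{ii}_{24}\},\{\mathrm{ii}_{03},\mathrm{ii}_{44}\},\{\mathrm{ii}_{03},\mathrm{ii}_{04}\}\}$; $r=\mathrm{ii}_{24}$: $S\in\{\{\mathrm{ii}_{34}\},\{\mathrm{ii}_{14},\mathrm{ii}_{03}\},\{\mathrm{ii}_{14},\mathrm{ii}_{44}\},\{\mathrm{ii}_{14},\mathrm{ii}_{04}\},\{\mathrm{ii}_{03},\mathrm{ii}_{44}\},\{\mathrm{ii}_{03},\mathrm{ii}_{04}\}\}$; $r=\mathrm{ii}_{04}$: $S\in\{\{\mathrm{ii}_{34}\},\{\mathrm{ii}_{14},\mathrm{ii}_{24}\},\{\mathrm{ii}_{14},\mathrm{ii}_{03}\},\{\mathrm{ii}_{14},\mathrm{ii}_{44}\},\{\mathrm{ii}_{03},\mathrm{ii}_{24}\},\{\mathrm{ii}_{03},\mathrm{ii}_{44}\}\}$;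 $r=\mathrm{ii}_{44}$: $S\in\{\{\mathrm{ii}_{34}\},\{\mathrm{ii}_{14},\mathrm{ii}_{24}\},\{\mathrm{ii}_{14},\mathrm{ii}_{03}\},\{\mathrm{ii}_{14},\mathrm{ii}_{04}\},\{\mathrm{ii}_{03},\mathrm{ii}_{24}\},\{\mathrm{ii}_{03},\mathrm{ii}_{04}\}\}$; $r\,=\,=_i$: $S\in\{\{\mathrm{ii}_{34}\},\{\mathrm{ii}_{14}\},\{\mathrm{ii}_{03}\}\}$.
   Context: Let $\mathbb D=(D,<)$ be a linear order; intervals are pairs $[a,b]$ of points of $D$ with $a<b$, and $\mathbb I(\mathbb D)$ is the set of intervals. An interval $[a,b]$ partitions $D$ into regions: $0=\{x<a\}$, $1=\{a\}$, $2=\{a<x<b\}$, $3=\{b\}$, $4=\{x>b\}$. For intervals, $[a,b]\,\mathrm{ii}_{kk'}\,[c,d]$ iff $c$ is in region $k$ and $d$ in region $k'$ of $[a,b]$; in particular $\mathrm{ii}_{34}$: $b=c$; $\mathrm{ii}_{44}$: $b<c$; $\mathrm{ii}_{14}$: $a=c,\ b<d$; $\mathrm{ii}_{03}$: $c<a,\ d=b$; $\mathrm{ii}_{04}$: $c<a,\ b<d$; $\mathrm{ii}_{24}$: $a<c<b<d$; $=_i$ is equality of intervals. For a set $S$ of such relations, $FO+S$ is two-sorted first-order logic without equality (sorts: points and intervals) whose only non-logical symbols are relation symbols for members of $S$, interpreted on the structure $\langle D,\mathbb I(\mathbb D)\rangle$. $FO+S$ defines $r$ over a class $\mathrm C$ of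 linear orders if there is an $FO+S$ formula $\varphi(x,y)$ with free variables exactly $x,y$ (of the sorts of $r$'s arguments) such that, for every $\mathbb D\in\mathrm C$ and all appropriate $x,y$, $\varphi(x,y)$ holds in $\langle D,\mathbb I(\mathbb D)\rangle$ iff $r(x,y)$ holds. -}

module Defs where

open import Level using (0ℓ)
open import Data.List using (List; []; _∷_)
open import Data.List.Membership.Propositional using (_∈_)
open import Data.Product using (_×_; _,_; Σ; Σ-syntax)
open import Data.Unit using (⊤; tt)
open import Data.Empty using (⊥)
open import Relation.Nullary using (¬_)
open import Relation.Binary.Bundles using (StrictTotalOrder)
open import Function.Bundles using (_⇔_)

-- Linear orders: a linear order (D,<) is a stdlib StrictTotalOrder
-- (strict, transitive, trichotomous; equality of points is the order's
-- _≈_).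

LinOrd : Set₁
LinOrd = StrictTotalOrder 0ℓ 0ℓ 0ℓ

module _ (O : LinOrd) where
  open StrictTotalOrder O renaming (Carrier to D)

  record Interval : Set where
    constructor [_,_]⟨_⟩
    field
      lo : D
      hi : D
      lo<hi : lo < hi


data Region : Set where
  R0 R1 R2 R3 R4 : Region

module _ (O : LinOrd) where
  open StrictTotalOrder O renaming (Carrier to D)

  InRegion : Region → D → Interval O → Set
  InRegion R0 x I = x < Interval.lo I
  InRegion R1 x I = x ≈ Interval.lo I
  InRegion R2 x I = (Interval.lo I < x) × (x < Interval.hi I)
  InRegion R3 x I = x ≈ Interval.hi I
  InRegion R4 x I = Interval.hi I < x

data IISym : Set where
  ii  : Region → Region → IISym
  =i  : IISym

ii34 ii44 ii14 ii03 ii04 ii24 : IISym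
ii34 = ii R3 R4
ii44 = ii R4 R4
ii14 = ii R1 R4
ii03 = ii R0 R3
ii04 = ii R0 R4
ii24 = ii R2 R4

module _ (O : LinOrd) where
  open StrictTotalOrder O renaming (Carrier to D)

  ⟦_⟧ˢ : IISym → Interval O → Interval O → Set
  ⟦ ii k k' ⟧ˢ I J = InRegion O k (Interval.lo J) I × InRegion O k' (Interval.hi J) I
  ⟦ =i ⟧ˢ I J = (Interval.lo I ≈ Interval.lo J) × (Interval.hi I ≈ Interval.hi J)

-- Two-sorted first-order logic without equality, FO + S.

data Sort : Set where
  pt iv : Sort

Ctx : Set
Ctx = List Sort

data Var : Ctx → Sort → Set where
  here  : ∀ {Γ s} → Var (s ∷ Γ) s
  there : ∀ {Γ s t} → Var Γ s → Var (t ∷ Γ) s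

-- Connectives: atoms, ¬, ∧, ∀ (a complete classical basis;
-- ∨, →, ∃ are the usual abbreviations).
data Formula (S : List IISym) : Ctx → Set where
  atom : ∀ {Γ} (R : IISym) → R ∈ S → Var Γ iv → Var Γ iv → Formula S Γ
  ¬'_  : ∀ {Γ} → Formula S Γ → Formula S Γ
  _∧'_ : ∀ {Γ} → Formula S Γ → Formula S Γ → Formula S Γ
  ∀'   : ∀ {Γ} (s : Sort) → Formula S (s ∷ Γ) → Formula S Γ

module _ (O : LinOrd) where
  open StrictTotalOrder O renaming (Carrier to D)

  Dom : Sort → Set
  Dom pt = D
  Dom iv = Interval O

  Env : Ctx → Set
  Env [] = ⊤
  Env (s ∷ Γ) = Dom s × Env Γ

  lookupEnv : ∀ {Γ s} → Env Γ → Var Γ s → Dom s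
  lookupEnv (v , _) here = v
  lookupEnv (_ , ρ) (there x) = lookupEnv ρ x

  Sat : ∀ {S Γ} → Formula S Γ → Env Γ → Set
  Sat (atom R _ x y) ρ = ⟦_⟧ˢ O R (lookupEnv ρ x) (lookupEnv ρ y)
  Sat (¬' φ) ρ = ¬ Sat φ ρ
  Sat (φ ∧' ψ) ρ = Sat φ ρ × Sat ψ ρ
  Sat (∀' s φ) ρ = (v : Dom s) → Sat φ (v , ρ)

Defines : IISym → List IISym → Set₁
Defines r S =
  Σ[ φ ∈ Formula S (iv ∷ iv ∷ []) ]
    ((O : LinOrd) (I J : Interval O) →
       Sat O φ (I , J , tt) ⇔ ⟦_⟧ˢ O r I J)

module Submission where

-- Everything goes through ii34, i.e. hi I = lo J.  Given it, "same start",
-- "same end", lo I < lo J, hi I < hi J and hi I < lo J are definable by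
-- pinning the endpoints of a witnessing interval, and ii14, ii24, ii04, ii44
-- and =i are conjunctions of these.  Conversely hi I = lo J holds iff
-- lo J is not below hi I but below the end of every proper right extension
-- of I, which needs ii14 and "same end" (and "same start", which ii14 gives:
-- two intervals are equal iff they have the same ii14-neighbours).  "Same
-- end" comes from ii44 (same ii44-successors), from ii24 or ii04 (compare the
-- proper right extensions of J with what I reaches), or from ii03.  Reversing
-- the order swaps ii14 and ii03 and preserves ii24, ii04, ii44 up to
-- converse, which handles the sets built on ii03.

open import Defs
open import Data.Empty using (⊥)
open import Data.List using (List; []; _∷_)
open import Data.List.Membership.Propositional using (_∈_)
open import Data.List.Relation.Unary.All using (All; []; _∷_)
import Data.List.Relation.Unary.Any as Any
open import Data.Product using (_×_; _,_; proj₁; proj₂)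
open import Data.Product.Function.NonDependent.Propositional using (_×-⇔_)
open import Data.Sum using (_⊎_; inj₁; inj₂; [_,_]′)
open import Data.Unit using (tt)
open import Function.Bundles using (_⇔_; mk⇔; Equivalence)
open import Function.Construct.Composition using (_⇔-∘_)
open import Function.Construct.Identity using (⇔-id)
open import Function.Construct.Symmetry using (⇔-sym)
open import Function.Related.TypeIsomorphisms using (¬-cong-⇔)
import Relation.Binary.Construct.Flip.Ord as Flip
open import Relation.Binary.Bundles using (StrictTotalOrder)
open import Relation.Binary.Definitions using (tri<; tri≈; tri>)
open import Relation.Binary.PropositionalEquality using (_≡_; refl; subst)
open import Relation.Nullary using (¬_; yes; no; contradiction)
open import Relation.Nullary.Decidable using (decidable-stable)

open Equivalence using (to; from)

-- ∨, →, ↔ and ∃ as expressed by the formula connectives ¬, ∧ and ∀.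
_⊎ᶜ_ _→ᶜ_ _↔ᶜ_ : Set → Set → Set
A ⊎ᶜ B = ¬ (¬ A × ¬ B)
A →ᶜ B = ¬ (A × ¬ B)
A ↔ᶜ B = (A →ᶜ B) × (B →ᶜ A)

∃ᶜ : {A : Set} → (A → Set) → Set
∃ᶜ P = ¬ (∀ x → ¬ P x)

module OrderFacts (O : LinOrd) where
  open StrictTotalOrder O public renaming (Carrier to D)

  <-≈-trans : ∀ {x y z} → x < y → y ≈ z → x < z
  <-≈-trans x<y y≈z = <-respʳ-≈ y≈z x<y

  ≈-<-trans : ∀ {x y z} → x ≈ y → y < z → x < z
  ≈-<-trans x≈y y<z = <-respˡ-≈ (Eq.sym x≈y) y<z

  <-irrefl : ∀ {x} → ¬ (x < x)
  <-irrefl = irrefl Eq.refl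

  ≮-<-trans : ∀ {x y z} → ¬ (y < x) → y < z → x < z
  ≮-<-trans {x} {y} y≮x y<z with compare x y
  ... | tri< x<y _ _ = trans x<y y<z
  ... | tri≈ _ x≈y _ = ≈-<-trans x≈y y<z
  ... | tri> _ _ y<x = contradiction y<x y≮x

  ≮∧≯⇒≈ : ∀ {x y} → ¬ (x < y) → ¬ (y < x) → x ≈ y
  ≮∧≯⇒≈ {x} {y} x≮y y≮x with compare x y
  ... | tri< x<y _ _ = contradiction x<y x≮y
  ... | tri≈ _ x≈y _ = x≈y
  ... | tri> _ _ y<x = contradiction y<x y≮x

  <-stable : ∀ {x y} → ¬ ¬ (x < y) → x < y
  <-stable = decidable-stable (_ <? _)

  ≈-stable : ∀ {x y} → ¬ ¬ (x ≈ y) → x ≈ y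
  ≈-stable = decidable-stable (_ ≟ _)

open Interval using (lo; hi; lo<hi)

Rel₂ Rel₃ : Set₁
Rel₂ = (O : LinOrd) → Interval O → Interval O → Set
Rel₃ = (O : LinOrd) → Interval O → Interval O → Interval O → Set

Starts Finishes Overlaps During Before Equal : Rel₂
Starts   O = ⟦_⟧ˢ O ii14
Finishes O = ⟦_⟧ˢ O ii03
Overlaps O = ⟦_⟧ˢ O ii24
During   O = ⟦_⟧ˢ O ii04
Before   O = ⟦_⟧ˢ O ii44
Equal    O = ⟦_⟧ˢ O =i

Meets SameStart SameEnd StartsBefore EndsBefore StartsBeforeEnd : Rel₂
Meets           O I J = StrictTotalOrder._≈_ O (hi I) (lo J)
SameStart       O I J = StrictTotalOrder._≈_ O (lo I) (lo J)
SameEnd         O I J = StrictTotalOrder._≈_ O (hi I) (hi J)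
StartsBefore    O I J = StrictTotalOrder._<_ O (lo I) (lo J)
EndsBefore      O I J = StrictTotalOrder._<_ O (hi I) (hi J)
StartsBeforeEnd O I J = StrictTotalOrder._<_ O (lo I) (hi J)

Extendable : (O : LinOrd) → Interval O → Set
Extendable O I = ∃ᶜ (Starts O I)

-- Tracks R I J: among the intervals starting with J, the proper right
-- extensions of J are exactly those that I reaches through R or Starts.
Tracks : Rel₂ → Rel₂
Tracks R O I J = ∀ K → SameStart O K J →ᶜ (Starts O J K ↔ᶜ (R O I K ⊎ᶜ Starts O I K))

SameEndVia : Rel₂ → Rel₂
SameEndVia R O I J =
  ((¬ Extendable O I × ¬ Extendable O J) ⊎ᶜ (¬ ¬ Extendable O J × Tracks R O I J))
  ⊎ᶜ (¬ ¬ Extendable O I × Tracks R O J I)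

-- Definability through a translation of orders

record Translation : Set₁ where
  field
    order          : LinOrd → LinOrd
    image          : ∀ {O} → Interval O → Interval (order O)
    preimage       : ∀ {O} → Interval (order O) → Interval O
    image-preimage : ∀ {O} (K : Interval (order O)) → image (preimage K) ≡ K
open Translation

identity : Translation
identity = record { order = λ O → O ; image = λ I → I ; preimage = λ I → I ; image-preimage = λ _ → refl }

reverse : LinOrd → LinOrd
reverse = Flip.strictTotalOrder

reverseInterval : ∀ {O} → Interval O → Interval (reverse O)
reverseInterval [ a , b ]⟨ a<b ⟩ = [ b , a ]⟨ a<b ⟩

reversal : Translation
reversal = record
  { order          = reverse
  ; image          = reverseInterval
  ; preimage       = λ { [ b , a ]⟨ a<b ⟩ → [ a , b ]⟨ a<b ⟩ }
  ; image-preimage = λ _ → refl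
  }

-- Reading ii03-formulas
-- through the reversal lets them play the role of ii14-formulas.
record Definable₂ (τ : Translation) (S : List IISym) (P : Rel₂) : Set₁ where
  field
    formula₂ : ∀ {Γ} → Var Γ iv → Var Γ iv → Formula S Γ
    sat₂     : ∀ O {Γ} (ρ : Env O Γ) (x y : Var Γ iv) →
               Sat O (formula₂ x y) ρ ⇔
               P (order τ O) (image τ (lookupEnv O ρ x)) (image τ (lookupEnv O ρ y))
open Definable₂

record Definable₃ (τ : Translation) (S : List IISym) (P : Rel₃) : Set₁ where
  field
    formula₃ : ∀ {Γ} → Var Γ iv → Var Γ iv → Var Γ iv → Formula S Γ
    sat₃     : ∀ O {Γ} (ρ : Env O Γ) (x y z : Var Γ iv) →
               Sat O (formula₃ x y z) ρ ⇔
               P (order τ O) (image τ (lookupEnv O ρ x)) (image τ (lookupEnv O ρ y))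
                 (image τ (lookupEnv O ρ z))
open Definable₃

module _ {τ : Translation} {S : List IISym} where

  transport₂ : ∀ {P Q} → Definable₂ τ S P → (∀ {O} (I J : Interval O) → P O I J ⇔ Q O I J) →
               Definable₂ τ S Q
  transport₂ d P⇔Q = record
    { formula₂ = formula₂ d ; sat₂ = λ O ρ x y → P⇔Q _ _ ⇔-∘ sat₂ d O ρ x y }

  atom₂ : ∀ {P} R → R ∈ S →
          (∀ O (I J : Interval O) → ⟦_⟧ˢ O R I J ⇔ P (order τ O) (image τ I) (image τ J)) →
          Definable₂ τ S P
  atom₂ R R∈S R⇔P = record
    { formula₂ = λ x y → atom R R∈S x y ; sat₂ = λ O ρ x y → R⇔P O _ _ }

  converse-atom₂ : ∀ {P} R → R ∈ S →
                   (∀ O (I J : Interval O) → ⟦_⟧ˢ O R J I ⇔ P (order τ O) (image τ I) (image τ J)) →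
                   Definable₂ τ S P
  converse-atom₂ R R∈S R⇔P = record
    { formula₂ = λ x y → atom R R∈S y x ; sat₂ = λ O ρ x y → R⇔P O _ _ }

  swap₂ : ∀ {P} → Definable₂ τ S P → Definable₂ τ S (λ O I J → P O J I)
  swap₂ d = record { formula₂ = λ x y → formula₂ d y x ; sat₂ = λ O ρ x y → sat₂ d O ρ y x }

  not₂ : ∀ {P} → Definable₂ τ S P → Definable₂ τ S (λ O I J → ¬ P O I J)
  not₂ d = record
    { formula₂ = λ x y → ¬' formula₂ d x y ; sat₂ = λ O ρ x y → ¬-cong-⇔ (sat₂ d O ρ x y) }

  and₂ : ∀ {P Q} → Definable₂ τ S P → Definable₂ τ S Q →
         Definable₂ τ S (λ O I J → P O I J × Q O I J)
  and₂ d e = record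
    { formula₂ = λ x y → formula₂ d x y ∧' formula₂ e x y
    ; sat₂     = λ O ρ x y → sat₂ d O ρ x y ×-⇔ sat₂ e O ρ x y }

  not₃ : ∀ {P} → Definable₃ τ S P → Definable₃ τ S (λ O I J K → ¬ P O I J K)
  not₃ d = record
    { formula₃ = λ x y z → ¬' formula₃ d x y z ; sat₃ = λ O ρ x y z → ¬-cong-⇔ (sat₃ d O ρ x y z) }

  and₃ : ∀ {P Q} → Definable₃ τ S P → Definable₃ τ S Q →
         Definable₃ τ S (λ O I J K → P O I J K × Q O I J K)
  and₃ d e = record
    { formula₃ = λ x y z → formula₃ d x y z ∧' formula₃ e x y z
    ; sat₃     = λ O ρ x y z → sat₃ d O ρ x y z ×-⇔ sat₃ e O ρ x y z }

  -- Quantifying over the preimage of K is enough because the translation is onto.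
  all₃ : ∀ {P} → Definable₃ τ S P → Definable₂ τ S (λ O I J → ∀ K → P O I J K)
  all₃ {P} d = record
    { formula₂ = λ x y → ∀' iv (formula₃ d (there x) (there y) here)
    ; sat₂     = λ O ρ x y → mk⇔
        (λ h K → subst (P _ _ _) (image-preimage τ K)
                       (to (sat₃ d O (preimage τ K , ρ) (there x) (there y) here) (h (preimage τ K))))
        (λ h K → from (sat₃ d O (K , ρ) (there x) (there y) here) (h (image τ K))) }

  over₁₃ : ∀ {P} → Definable₂ τ S P → Definable₃ τ S (λ O I J K → P O I K)
  over₁₃ d = record { formula₃ = λ x y z → formula₂ d x z ; sat₃ = λ O ρ x y z → sat₂ d O ρ x z }

  over₂₃ : ∀ {P} → Definable₂ τ S P → Definable₃ τ S (λ O I J K → P O J K)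
  over₂₃ d = record { formula₃ = λ x y z → formula₂ d y z ; sat₃ = λ O ρ x y z → sat₂ d O ρ y z }

  over₃₁ : ∀ {P} → Definable₂ τ S P → Definable₃ τ S (λ O I J K → P O K I)
  over₃₁ d = record { formula₃ = λ x y z → formula₂ d z x ; sat₃ = λ O ρ x y z → sat₂ d O ρ z x }

  over₃₂ : ∀ {P} → Definable₂ τ S P → Definable₃ τ S (λ O I J K → P O K J)
  over₃₂ d = record { formula₃ = λ x y z → formula₂ d z y ; sat₃ = λ O ρ x y z → sat₂ d O ρ z y }

  or₂ : ∀ {P Q} → Definable₂ τ S P → Definable₂ τ S Q → Definable₂ τ S (λ O I J → P O I J ⊎ᶜ Q O I J)
  or₂ d e = not₂ (and₂ (not₂ d) (not₂ e))

  implies₂ : ∀ {P Q} → Definable₂ τ S P → Definable₂ τ S Q → Definable₂ τ S (λ O I J → P O I J →ᶜ Q O I J)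
  implies₂ d e = not₂ (and₂ d (not₂ e))

  iff₂ : ∀ {P Q} → Definable₂ τ S P → Definable₂ τ S Q → Definable₂ τ S (λ O I J → P O I J ↔ᶜ Q O I J)
  iff₂ d e = and₂ (implies₂ d e) (implies₂ e d)

  or₃ : ∀ {P Q} → Definable₃ τ S P → Definable₃ τ S Q →
        Definable₃ τ S (λ O I J K → P O I J K ⊎ᶜ Q O I J K)
  or₃ d e = not₃ (and₃ (not₃ d) (not₃ e))

  implies₃ : ∀ {P Q} → Definable₃ τ S P → Definable₃ τ S Q →
             Definable₃ τ S (λ O I J K → P O I J K →ᶜ Q O I J K)
  implies₃ d e = not₃ (and₃ d (not₃ e))

  iff₃ : ∀ {P Q} → Definable₃ τ S P → Definable₃ τ S Q →
         Definable₃ τ S (λ O I J K → P O I J K ↔ᶜ Q O I J K)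
  iff₃ d e = and₃ (implies₃ d e) (implies₃ e d)

  exists₃ : ∀ {P} → Definable₃ τ S P → Definable₂ τ S (λ O I J → ∃ᶜ (P O I J))
  exists₃ d = not₂ (all₃ (not₃ d))

  untranslate : ∀ {P Q} → Definable₂ τ S P →
                (∀ {O} (I J : Interval O) → P (order τ O) (image τ I) (image τ J) ⇔ Q O I J) →
                Definable₂ identity S Q
  untranslate d P⇔Q = record
    { formula₂ = formula₂ d ; sat₂ = λ O ρ x y → P⇔Q _ _ ⇔-∘ sat₂ d O ρ x y }

symbol : ∀ {S R} → R ∈ S → Definable₂ identity S (λ O → ⟦_⟧ˢ O R)
symbol {R = R} R∈S = atom₂ R R∈S (λ O I J → ⇔-id _)

defines : ∀ {S} r → Definable₂ identity S (λ O → ⟦_⟧ˢ O r) → Defines r S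
defines _ d = formula₂ d here (there here) , λ O I J → sat₂ d O (I , J , tt) here (there here)

-- Characterisations inside one linear order

module _ {O : LinOrd} where
  open OrderFacts O

  StartsIndiscernible : Interval O → Interval O → Set
  StartsIndiscernible I J =
    ∀ K → (Starts O K I ↔ᶜ Starts O K J) × (Starts O I K ↔ᶜ Starts O J K)

  private
    indiscernible-sym : ∀ {I J} → StartsIndiscernible I J → StartsIndiscernible J I
    indiscernible-sym h K with h K
    ... | (KI→KJ , KJ→KI) , (IK→JK , JK→IK) = (KJ→KI , KI→KJ) , (JK→IK , IK→JK)

    -- When lo I < lo J, the interval [lo I, lo J] (if lo J < hi I) or [lo I, hi J]
    -- (otherwise) is related by Starts to I but not to J.
    indiscernible⇒lo≮lo : ∀ {I J} → StartsIndiscernible I J → ¬ StartsBefore O I J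
    indiscernible⇒lo≮lo {I} {J} h a<c with lo J <? hi I
    ... | yes c<b = proj₁ (proj₁ (h [ lo I , lo J ]⟨ a<c ⟩))
                      ((Eq.refl , c<b) , λ KJ → irrefl (Eq.sym (proj₁ KJ)) a<c)
    ... | no c≮b  = proj₁ (proj₂ (h [ lo I , hi J ]⟨ trans a<c (lo<hi J) ⟩))
                      ((Eq.refl , ≮-<-trans c≮b (lo<hi J)) , λ JK → irrefl (proj₁ JK) a<c)

    indiscernible⇒hi≮hi : ∀ {I J} → StartsIndiscernible I J → SameStart O I J → ¬ EndsBefore O I J
    indiscernible⇒hi≮hi {I} {J} h a≈c b<d =
      proj₁ (proj₂ (h J)) ((Eq.sym a≈c , b<d) , λ JJ → <-irrefl (proj₂ JJ))

  starts-extensional : ∀ (I J : Interval O) → StartsIndiscernible I J ⇔ Equal O I J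
  starts-extensional I J = mk⇔ to-equal from-equal
    where
    to-equal : StartsIndiscernible I J → Equal O I J
    to-equal h = a≈c , ≮∧≯⇒≈ (indiscernible⇒hi≮hi {I} {J} h a≈c)
                              (indiscernible⇒hi≮hi {J} {I} h′ (Eq.sym a≈c))
      where
      h′ : StartsIndiscernible J I
      h′ = indiscernible-sym {I} {J} h
      a≈c : SameStart O I J
      a≈c = ≮∧≯⇒≈ (indiscernible⇒lo≮lo {I} {J} h) (indiscernible⇒lo≮lo {J} {I} h′)
    from-equal : Equal O I J → StartsIndiscernible I J
    from-equal (a≈c , b≈d) K =
      ( (λ (KI , ¬KJ) → ¬KJ (Eq.trans (Eq.sym a≈c) (proj₁ KI) , <-≈-trans (proj₂ KI) b≈d))
      , (λ (KJ , ¬KI) → ¬KI (Eq.trans a≈c (proj₁ KJ) , <-≈-trans (proj₂ KJ) (Eq.sym b≈d))) )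
      , ( (λ (IK , ¬JK) → ¬JK (Eq.trans (proj₁ IK) a≈c , ≈-<-trans (Eq.sym b≈d) (proj₂ IK)))
        , (λ (JK , ¬IK) → ¬IK (Eq.trans (proj₁ JK) (Eq.sym a≈c) , ≈-<-trans b≈d (proj₂ JK))) )

  sameStart-via-starts : ∀ (I J : Interval O) →
    ((Starts O I J ⊎ᶜ Starts O J I) ⊎ᶜ Equal O I J) ⇔ SameStart O I J
  sameStart-via-starts I J = mk⇔ to-sameStart from-sameStart
    where
    to-sameStart : ((Starts O I J ⊎ᶜ Starts O J I) ⊎ᶜ Equal O I J) → SameStart O I J
    to-sameStart h = ≈-stable λ a≉c →
      h ((λ ¬starts → ¬starts ((λ IJ → a≉c (Eq.sym (proj₁ IJ))) , (λ JI → a≉c (proj₁ JI))))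
        , λ IJ → a≉c (proj₁ IJ))
    from-sameStart : SameStart O I J → (Starts O I J ⊎ᶜ Starts O J I) ⊎ᶜ Equal O I J
    from-sameStart a≈c (¬starts , ¬equal) = ¬starts λ (¬IJ , ¬JI) → by-ends ¬IJ ¬JI
      where
      by-ends : ¬ Starts O I J → ¬ Starts O J I → ⊥
      by-ends ¬IJ ¬JI with compare (hi I) (hi J)
      ... | tri< b<d _ _ = ¬IJ (Eq.sym a≈c , b<d)
      ... | tri≈ _ b≈d _ = ¬equal (a≈c , b≈d)
      ... | tri> _ _ d<b = ¬JI (a≈c , d<b)

  pinned-interval⇔< : ∀ (x y : D) (AtStart AtEnd : Interval O → Set) →
    (∀ {K} → AtStart K → lo K ≈ x) → (∀ {K} → AtEnd K → hi K ≈ y) →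
    ((x<y : x < y) → AtStart [ x , y ]⟨ x<y ⟩ × AtEnd [ x , y ]⟨ x<y ⟩) →
    ∃ᶜ (λ K → AtStart K × AtEnd K) ⇔ (x < y)
  pinned-interval⇔< x y AtStart AtEnd start≈ end≈ [x,y] = mk⇔
    (λ h → <-stable λ x≮y → h λ K (s , e) →
       x≮y (≈-<-trans (Eq.sym (start≈ s)) (<-≈-trans (lo<hi K) (end≈ e))))
    (λ x<y h → h _ ([x,y] x<y))

  startsBeforeEnd-via-sameStart-sameEnd : ∀ (I J : Interval O) →
    ∃ᶜ (λ K → SameStart O K I × SameEnd O K J) ⇔ StartsBeforeEnd O I J
  startsBeforeEnd-via-sameStart-sameEnd I J =
    pinned-interval⇔< (lo I) (hi J) (λ K → SameStart O K I) (λ K → SameEnd O K J)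
                      (λ e → e) (λ e → e) (λ _ → Eq.refl , Eq.refl)

  meets-via-starts : ∀ (I J : Interval O) →
    (¬ StartsBeforeEnd O J I × (∀ K → Starts O I K →ᶜ StartsBeforeEnd O J K)) ⇔ Meets O I J
  meets-via-starts I J = mk⇔ to-meets from-meets
    where
    to-meets : ¬ StartsBeforeEnd O J I × (∀ K → Starts O I K →ᶜ StartsBeforeEnd O J K) → Meets O I J
    to-meets (c≮b , h) = ≮∧≯⇒≈ b≮c c≮b
      where
      b≮c : ¬ (hi I < lo J)
      b≮c b<c = h [ lo I , lo J ]⟨ trans (lo<hi I) b<c ⟩ ((Eq.refl , b<c) , <-irrefl)
    from-meets : Meets O I J → ¬ StartsBeforeEnd O J I × (∀ K → Starts O I K →ᶜ StartsBeforeEnd O J K)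
    from-meets b≈c = irrefl (Eq.sym b≈c) , λ K (IK , c≮d) → c≮d (≈-<-trans (Eq.sym b≈c) (proj₂ IK))

  extendable-if-hi< : ∀ {I t} → hi I < t → Extendable O I
  extendable-if-hi< {I} {t} b<t ¬ext = ¬ext [ lo I , t ]⟨ trans (lo<hi I) b<t ⟩ (Eq.refl , b<t)

  extendable-resp-sameEnd : ∀ {I J} → SameEnd O I J → Extendable O I → Extendable O J
  extendable-resp-sameEnd {I} {J} b≈d extI ¬extJ =
    extI λ K IK → extendable-if-hi< {J} (≈-<-trans (Eq.sym b≈d) (proj₂ IK)) ¬extJ

  sameEnd-via-before : ∀ (I J : Interval O) →
    ((∀ K → Before O I K ↔ᶜ Before O J K) × (Extendable O I ↔ᶜ Extendable O J)) ⇔ SameEnd O I J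
  sameEnd-via-before I J = mk⇔ to-sameEnd from-sameEnd
    where
    -- If hi I < hi J, either J has a proper right extension K, and then
    -- [hi J, hi K] is before I but not J, or J has none while I has one.
    hi≮hi : ∀ {I J} → (∀ K → Before O I K →ᶜ Before O J K) → (Extendable O I →ᶜ Extendable O J) →
            ¬ EndsBefore O I J
    hi≮hi {I} {J} before→ ext→ b<d = ext→ (extendable-if-hi< {I} b<d , λ extJ → extJ λ K JK →
      before→ [ hi J , hi K ]⟨ proj₂ JK ⟩ ((b<d , trans b<d (proj₂ JK)) , λ JK′ → <-irrefl (proj₁ JK′)))
    to-sameEnd : (∀ K → Before O I K ↔ᶜ Before O J K) × (Extendable O I ↔ᶜ Extendable O J) →
                 SameEnd O I J
    to-sameEnd (before↔ , ext→ , ext←) =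
      ≮∧≯⇒≈ (hi≮hi {I} {J} (λ K → proj₁ (before↔ K)) ext→) (hi≮hi {J} {I} (λ K → proj₂ (before↔ K)) ext←)
    from-sameEnd : SameEnd O I J →
                   (∀ K → Before O I K ↔ᶜ Before O J K) × (Extendable O I ↔ᶜ Extendable O J)
    from-sameEnd b≈d =
      (λ K → (λ ((b<c , b<e) , ¬JK) → ¬JK (≈-<-trans (Eq.sym b≈d) b<c , ≈-<-trans (Eq.sym b≈d) b<e))
           , (λ ((d<c , d<e) , ¬IK) → ¬IK (≈-<-trans b≈d d<c , ≈-<-trans b≈d d<e)))
      , (λ (extI , ¬extJ) → ¬extJ (extendable-resp-sameEnd {I} {J} b≈d extI))
      , (λ (extJ , ¬extI) → ¬extI (extendable-resp-sameEnd {J} {I} (Eq.sym b≈d) extJ))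

  module _ (R : Rel₂)
           (R-shrink : ∀ I J K → SameStart O K J → EndsBefore O I J → R O I K → R O I J)
           (R⇒endsBefore : ∀ I K → R O I K → EndsBefore O I K) where

    private
      tracked-extension : ∀ {I J} → Tracks R O I J → ∀ K → SameStart O K J → Starts O J K →
                          R O I K ⊎ᶜ Starts O I K
      tracked-extension g K k≈c JK ¬reached = g K (k≈c , λ (JK→ , _) → JK→ (JK , λ reached → reached ¬reached))

      reached-extension : ∀ {I J} → Tracks R O I J → ∀ K → SameStart O K J →
                          R O I K ⊎ᶜ Starts O I K → Starts O J K
      reached-extension g K k≈c reached =
        k≈c , <-stable λ d≮e → g K (k≈c , λ (_ , reached→) → reached→ (reached , λ JK → d≮e (proj₂ JK)))

    tracks⇒sameEnd : ∀ {I J} → Tracks R O I J → Extendable O J → SameEnd O I J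
    tracks⇒sameEnd {I} {J} g extJ = ≮∧≯⇒≈ b≮d d≮b
      where
      d≮b : ¬ (hi J < hi I)
      d≮b d<b = tracked-extension {I} {J} g [ lo J , hi I ]⟨ trans (lo<hi J) d<b ⟩ Eq.refl (Eq.refl , d<b)
                  ((λ r → <-irrefl (R⇒endsBefore _ _ r)) , λ IK → <-irrefl (proj₂ IK))
      b≮d : ¬ (hi I < hi J)
      b≮d b<d = <-irrefl (proj₂ (reached-extension {I} {J} g J Eq.refl reachesJ))
        where
        reachesJ : R O I J ⊎ᶜ Starts O I J
        reachesJ (¬R , ¬S) = extJ λ K JK → tracked-extension {I} {J} g K (proj₁ JK) JK
          ( (λ r → ¬R (R-shrink _ _ _ (proj₁ JK) b<d r))
          , (λ IK → ¬S (Eq.trans (Eq.sym (proj₁ JK)) (proj₁ IK) , b<d)) )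

    tracks-intro : ∀ I J → SameEnd O I J →
      (∀ K → SameStart O K J → EndsBefore O J K → R O I K ⊎ Starts O I K) → Tracks R O I J
    tracks-intro I J b≈d reaches K (k≈c , ¬↔) = ¬↔ (extension→reached , reached→extension)
      where
      extension→reached : Starts O J K →ᶜ (R O I K ⊎ᶜ Starts O I K)
      extension→reached (JK , ¬reached) = ¬reached λ (¬R , ¬S) → [ ¬R , ¬S ]′ (reaches K k≈c (proj₂ JK))
      reached→extension : (R O I K ⊎ᶜ Starts O I K) →ᶜ Starts O J K
      reached→extension (reached , ¬JK) = reached
        ( (λ r → ¬JK (k≈c , ≈-<-trans (Eq.sym b≈d) (R⇒endsBefore _ _ r)))
        , (λ IK → ¬JK (k≈c , ≈-<-trans (Eq.sym b≈d) (proj₂ IK))) )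

    sameEnd-via-tracks : (∀ I J → SameEnd O I J → Tracks R O I J ⊎ Tracks R O J I) →
                         ∀ (I J : Interval O) → SameEndVia R O I J ⇔ SameEnd O I J
    sameEnd-via-tracks tracks-total I J = mk⇔ to-sameEnd from-sameEnd
      where
      to-sameEnd : SameEndVia R O I J → SameEnd O I J
      to-sameEnd h = ≈-stable λ b≉d → h
        ( (λ ¬cases → ¬cases
            ( (λ (¬extI , ¬extJ) → b≉d (≮∧≯⇒≈ (λ b<d → ¬extI (extendable-if-hi< {I} b<d))
                                               (λ d<b → ¬extJ (extendable-if-hi< {J} d<b))))
            , (λ (¬¬extJ , g) → ¬¬extJ λ extJ → b≉d (tracks⇒sameEnd {I} {J} g extJ)) ))
        , (λ (¬¬extI , g) → ¬¬extI λ extI → b≉d (Eq.sym (tracks⇒sameEnd {J} {I} g extI))) )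
      from-sameEnd : SameEnd O I J → SameEndVia R O I J
      from-sameEnd b≈d (¬¬cases , ¬third) =
        ¬¬cases λ (¬first , ¬second) → by-tracking ¬first ¬second (tracks-total I J b≈d)
        where
        resp : Extendable O I → Extendable O J
        resp = extendable-resp-sameEnd {I} {J} b≈d
        resp⁻ : Extendable O J → Extendable O I
        resp⁻ = extendable-resp-sameEnd {J} {I} (Eq.sym b≈d)
        by-tracking : ¬ (¬ Extendable O I × ¬ Extendable O J) → ¬ (¬ ¬ Extendable O J × Tracks R O I J) →
                      Tracks R O I J ⊎ Tracks R O J I → ⊥
        by-tracking ¬first ¬second (inj₁ g) =
          ¬second ((λ ¬extJ → ¬first ((λ extI → ¬extJ (resp extI)) , ¬extJ)) , g)
        by-tracking ¬first ¬second (inj₂ g) =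
          ¬third ((λ ¬extI → ¬first (¬extI , λ extJ → ¬extI (resp⁻ extJ))) , g)

  -- Of two intervals with a common end, the one starting first tracks the other;
  -- for During it is the one starting later.
  sameEnd-via-overlaps : ∀ (I J : Interval O) → SameEndVia Overlaps O I J ⇔ SameEnd O I J
  sameEnd-via-overlaps = sameEnd-via-tracks Overlaps shrink ends-before total
    where
    shrink : ∀ I J K → SameStart O K J → EndsBefore O I J → Overlaps O I K → Overlaps O I J
    shrink _ _ _ k≈c b<d ((a<k , k<b) , _) = (<-≈-trans a<k k≈c , ≈-<-trans (Eq.sym k≈c) k<b) , b<d
    ends-before : ∀ I K → Overlaps O I K → EndsBefore O I K
    ends-before _ _ (_ , b<e) = b<e
    tracks : ∀ I J → SameEnd O I J → lo I < lo J → Tracks Overlaps O I J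
    tracks I J b≈d a<c = tracks-intro Overlaps shrink ends-before I J b≈d λ K k≈c d<e →
      inj₁ ((<-≈-trans a<c (Eq.sym k≈c) , ≈-<-trans k≈c (<-≈-trans (lo<hi J) (Eq.sym b≈d))) , ≈-<-trans b≈d d<e)
    total : ∀ I J → SameEnd O I J → Tracks Overlaps O I J ⊎ Tracks Overlaps O J I
    total I J b≈d with compare (lo I) (lo J)
    ... | tri< a<c _ _ = inj₁ (tracks I J b≈d a<c)
    ... | tri≈ _ a≈c _ = inj₁ (tracks-intro Overlaps shrink ends-before I J b≈d λ K k≈c d<e →
                           inj₂ (Eq.trans k≈c (Eq.sym a≈c) , ≈-<-trans b≈d d<e))
    ... | tri> _ _ c<a = inj₂ (tracks J I (Eq.sym b≈d) c<a)

  sameEnd-via-during : ∀ (I J : Interval O) → SameEndVia During O I J ⇔ SameEnd O I J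
  sameEnd-via-during = sameEnd-via-tracks During shrink ends-before total
    where
    shrink : ∀ I J K → SameStart O K J → EndsBefore O I J → During O I K → During O I J
    shrink _ _ _ k≈c b<d (k<a , _) = ≈-<-trans (Eq.sym k≈c) k<a , b<d
    ends-before : ∀ I K → During O I K → EndsBefore O I K
    ends-before _ _ (_ , b<e) = b<e
    tracks : ∀ I J → SameEnd O I J → lo J < lo I → Tracks During O I J
    tracks I J b≈d c<a = tracks-intro During shrink ends-before I J b≈d λ K k≈c d<e →
      inj₁ (≈-<-trans k≈c c<a , ≈-<-trans b≈d d<e)
    total : ∀ I J → SameEnd O I J → Tracks During O I J ⊎ Tracks During O J I
    total I J b≈d with compare (lo I) (lo J)
    ... | tri< a<c _ _ = inj₂ (tracks J I (Eq.sym b≈d) a<c)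
    ... | tri≈ _ a≈c _ = inj₁ (tracks-intro During shrink ends-before I J b≈d λ K k≈c d<e →
                           inj₂ (Eq.trans k≈c (Eq.sym a≈c) , ≈-<-trans b≈d d<e))
    ... | tri> _ _ c<a = inj₁ (tracks I J b≈d c<a)

  sameStart-via-meets : ∀ (I J : Interval O) →
    (∀ K → Meets O K I ↔ᶜ Meets O K J) ⇔ SameStart O I J
  sameStart-via-meets I J = mk⇔ to-sameStart from-sameStart
    where
    to-sameStart : (∀ K → Meets O K I ↔ᶜ Meets O K J) → SameStart O I J
    to-sameStart h =
      ≮∧≯⇒≈ (λ a<c → proj₂ (h [ lo I , lo J ]⟨ a<c ⟩) (Eq.refl , λ c≈a → irrefl (Eq.sym c≈a) a<c))
            (λ c<a → proj₁ (h [ lo J , lo I ]⟨ c<a ⟩) (Eq.refl , λ a≈c → irrefl (Eq.sym a≈c) c<a))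
    from-sameStart : SameStart O I J → ∀ K → Meets O K I ↔ᶜ Meets O K J
    from-sameStart a≈c K = (λ (KI , ¬KJ) → ¬KJ (Eq.trans KI a≈c))
                         , (λ (KJ , ¬KI) → ¬KI (Eq.trans KJ (Eq.sym a≈c)))

  sameEnd-via-meets : ∀ (I J : Interval O) →
    (∀ K → Meets O I K ↔ᶜ Meets O J K) ⇔ SameEnd O I J
  sameEnd-via-meets I J = mk⇔ to-sameEnd from-sameEnd
    where
    to-sameEnd : (∀ K → Meets O I K ↔ᶜ Meets O J K) → SameEnd O I J
    to-sameEnd h =
      ≮∧≯⇒≈ (λ b<d → proj₁ (h [ hi I , hi J ]⟨ b<d ⟩) (Eq.refl , λ d≈b → irrefl (Eq.sym d≈b) b<d))
            (λ d<b → proj₂ (h [ hi J , hi I ]⟨ d<b ⟩) (Eq.refl , λ b≈d → irrefl (Eq.sym b≈d) d<b))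
    from-sameEnd : SameEnd O I J → ∀ K → Meets O I K ↔ᶜ Meets O J K
    from-sameEnd b≈d K = (λ (IK , ¬JK) → ¬JK (Eq.trans (Eq.sym b≈d) IK))
                       , (λ (JK , ¬IK) → ¬IK (Eq.trans b≈d JK))

  before-via-meets : ∀ (I J : Interval O) → ∃ᶜ (λ K → Meets O I K × Meets O K J) ⇔ Before O I J
  before-via-meets I J = mk⇔ (λ h → let b<c = to gap h in b<c , trans b<c (lo<hi J))
                             (λ (b<c , _) → from gap b<c)
    where
    gap : ∃ᶜ (λ K → Meets O I K × Meets O K J) ⇔ (hi I < lo J)
    gap = pinned-interval⇔< (hi I) (lo J) (Meets O I) (λ K → Meets O K J) Eq.sym (λ e → e)
                            (λ _ → Eq.refl , Eq.refl)

  endsBefore-via-meets : ∀ (I J : Interval O) →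
    ∃ᶜ (λ K → Meets O I K × SameEnd O K J) ⇔ EndsBefore O I J
  endsBefore-via-meets I J =
    pinned-interval⇔< (hi I) (hi J) (Meets O I) (λ K → SameEnd O K J) Eq.sym (λ e → e)
                      (λ _ → Eq.refl , Eq.refl)

  startsBefore-via-meets : ∀ (I J : Interval O) →
    ∃ᶜ (λ K → SameStart O K I × Meets O K J) ⇔ StartsBefore O I J
  startsBefore-via-meets I J =
    pinned-interval⇔< (lo I) (lo J) (λ K → SameStart O K I) (λ K → Meets O K J) (λ e → e) (λ e → e)
                      (λ _ → Eq.refl , Eq.refl)


  meets⇔ii34 : ∀ (I J : Interval O) → Meets O I J ⇔ ⟦_⟧ˢ O ii34 I J
  meets⇔ii34 I J = mk⇔ (λ b≈c → Eq.sym b≈c , ≈-<-trans b≈c (lo<hi J)) (λ (c≈b , _) → Eq.sym c≈b)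

  finishes⇔reversed-starts : ∀ (I J : Interval O) →
    Finishes O I J ⇔ Starts (reverse O) (reverseInterval I) (reverseInterval J)
  finishes⇔reversed-starts I J = mk⇔ (λ (c<a , d≈b) → Eq.sym d≈b , c<a) (λ (b≈d , c<a) → c<a , Eq.sym b≈d)

  during⇔reversed-during : ∀ (I J : Interval O) →
    During O I J ⇔ During (reverse O) (reverseInterval I) (reverseInterval J)
  during⇔reversed-during I J = mk⇔ (λ (c<a , b<d) → b<d , c<a) (λ (b<d , c<a) → c<a , b<d)

  before⇔reversed-before : ∀ (I J : Interval O) →
    Before O J I ⇔ Before (reverse O) (reverseInterval I) (reverseInterval J)
  before⇔reversed-before I J =
    mk⇔ (λ (d<a , _) → d<a , trans (lo<hi J) d<a) (λ (d<a , _) → d<a , trans d<a (lo<hi I))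

  overlaps⇔reversed-overlaps : ∀ (I J : Interval O) →
    Overlaps O J I ⇔ Overlaps (reverse O) (reverseInterval I) (reverseInterval J)
  overlaps⇔reversed-overlaps I J =
    mk⇔ (λ ((c<a , a<d) , d<b) → (d<b , a<d) , c<a) (λ ((d<b , a<d) , c<a) → (c<a , a<d) , d<b)

  reversed-meets⇔meets : ∀ (I J : Interval O) →
    Meets (reverse O) (reverseInterval J) (reverseInterval I) ⇔ Meets O I J
  reversed-meets⇔meets I J = ⇔-id _

  reversed-sameStart⇔sameEnd : ∀ (I J : Interval O) →
    SameStart (reverse O) (reverseInterval I) (reverseInterval J) ⇔ SameEnd O I J
  reversed-sameStart⇔sameEnd I J = mk⇔ Eq.sym Eq.sym

  reversed-equal⇔equal : ∀ (I J : Interval O) →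
    Equal (reverse O) (reverseInterval I) (reverseInterval J) ⇔ Equal O I J
  reversed-equal⇔equal I J =
    mk⇔ (λ (d≈b , c≈a) → Eq.sym c≈a , Eq.sym d≈b) (λ (a≈c , b≈d) → Eq.sym b≈d , Eq.sym a≈c)

-- Definable relations

module _ {τ : Translation} {S : List IISym} where

  equal-from-starts : Definable₂ τ S Starts → Definable₂ τ S Equal
  equal-from-starts st = transport₂
    (all₃ (and₃ (iff₃ (over₃₁ st) (over₃₂ st)) (iff₃ (over₁₃ st) (over₂₃ st))))
    starts-extensional

  sameStart-from-starts : Definable₂ τ S Starts → Definable₂ τ S SameStart
  sameStart-from-starts st = transport₂ (or₂ (or₂ st (swap₂ st)) (equal-from-starts st)) sameStart-via-starts

  extendable-from-starts : Definable₂ τ S Starts → Definable₂ τ S (λ O I J → Extendable O I)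
  extendable-from-starts st = exists₃ (over₁₃ st)

  startsBeforeEnd-from-sameStart-sameEnd : Definable₂ τ S SameStart → Definable₂ τ S SameEnd →
                                          Definable₂ τ S StartsBeforeEnd
  startsBeforeEnd-from-sameStart-sameEnd ss se =
    transport₂ (exists₃ (and₃ (over₃₁ ss) (over₃₂ se))) startsBeforeEnd-via-sameStart-sameEnd

  meets-from-starts-sameEnd : Definable₂ τ S Starts → Definable₂ τ S SameEnd → Definable₂ τ S Meets
  meets-from-starts-sameEnd st se =
    transport₂ (and₂ (not₂ (swap₂ sbe)) (all₃ (implies₃ (over₁₃ st) (over₂₃ sbe)))) meets-via-starts
    where
    sbe : Definable₂ τ S StartsBeforeEnd
    sbe = startsBeforeEnd-from-sameStart-sameEnd (sameStart-from-starts st) se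

  sameEnd-from-starts-before : Definable₂ τ S Starts → Definable₂ τ S Before → Definable₂ τ S SameEnd
  sameEnd-from-starts-before st b =
    transport₂ (and₂ (all₃ (iff₃ (over₁₃ b) (over₂₃ b))) (iff₂ ext (swap₂ ext))) sameEnd-via-before
    where
    ext : Definable₂ τ S (λ O I J → Extendable O I)
    ext = extendable-from-starts st

  sameEnd-from-starts-tracking : ∀ {R} → Definable₂ τ S Starts → Definable₂ τ S R →
    (∀ {O} (I J : Interval O) → SameEndVia R O I J ⇔ SameEnd O I J) → Definable₂ τ S SameEnd
  sameEnd-from-starts-tracking st r via = transport₂
    (or₂ (or₂ (and₂ max (swap₂ max)) (and₂ (not₂ (swap₂ max)) tracks)) (and₂ (not₂ max) (swap₂ tracks)))
    via
    where
    max : Definable₂ τ S (λ O I J → ¬ Extendable O I)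
    max = not₂ (extendable-from-starts st)
    tracks : Definable₂ τ S (Tracks _)
    tracks = all₃ (implies₃ (over₃₂ (sameStart-from-starts st))
                            (iff₃ (over₂₃ st) (or₃ (over₁₃ r) (over₁₃ st))))

  meets-from-starts-before : Definable₂ τ S Starts → Definable₂ τ S Before → Definable₂ τ S Meets
  meets-from-starts-before st b = meets-from-starts-sameEnd st (sameEnd-from-starts-before st b)

  meets-from-starts-overlaps : Definable₂ τ S Starts → Definable₂ τ S Overlaps → Definable₂ τ S Meets
  meets-from-starts-overlaps st ov =
    meets-from-starts-sameEnd st (sameEnd-from-starts-tracking st ov sameEnd-via-overlaps)

  meets-from-starts-during : Definable₂ τ S Starts → Definable₂ τ S During → Definable₂ τ S Meets
  meets-from-starts-during st du =
    meets-from-starts-sameEnd st (sameEnd-from-starts-tracking st du sameEnd-via-during)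

  sameStart-from-meets : Definable₂ τ S Meets → Definable₂ τ S SameStart
  sameStart-from-meets m = transport₂ (all₃ (iff₃ (over₃₁ m) (over₃₂ m))) sameStart-via-meets

  sameEnd-from-meets : Definable₂ τ S Meets → Definable₂ τ S SameEnd
  sameEnd-from-meets m = transport₂ (all₃ (iff₃ (over₁₃ m) (over₂₃ m))) sameEnd-via-meets

  endsBefore-from-meets : Definable₂ τ S Meets → Definable₂ τ S EndsBefore
  endsBefore-from-meets m =
    transport₂ (exists₃ (and₃ (over₁₃ m) (over₃₂ (sameEnd-from-meets m)))) endsBefore-via-meets

  startsBefore-from-meets : Definable₂ τ S Meets → Definable₂ τ S StartsBefore
  startsBefore-from-meets m =
    transport₂ (exists₃ (and₃ (over₃₁ (sameStart-from-meets m)) (over₃₂ m))) startsBefore-via-meets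

  ii34-from-meets : Definable₂ τ S Meets → Definable₂ τ S (λ O → ⟦_⟧ˢ O ii34)
  ii34-from-meets m = transport₂ m meets⇔ii34

  starts-from-meets : Definable₂ τ S Meets → Definable₂ τ S Starts
  starts-from-meets m = and₂ (swap₂ (sameStart-from-meets m)) (endsBefore-from-meets m)

  overlaps-from-meets : Definable₂ τ S Meets → Definable₂ τ S Overlaps
  overlaps-from-meets m =
    and₂ (and₂ (startsBefore-from-meets m) (swap₂ sbe)) (endsBefore-from-meets m)
    where
    sbe : Definable₂ τ S StartsBeforeEnd
    sbe = startsBeforeEnd-from-sameStart-sameEnd (sameStart-from-meets m) (sameEnd-from-meets m)

  during-from-meets : Definable₂ τ S Meets → Definable₂ τ S During
  during-from-meets m = and₂ (swap₂ (startsBefore-from-meets m)) (endsBefore-from-meets m)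

  before-from-meets : Definable₂ τ S Meets → Definable₂ τ S Before
  before-from-meets m = transport₂ (exists₃ (and₃ (over₁₃ m) (over₃₂ m))) before-via-meets

  equal-from-meets : Definable₂ τ S Meets → Definable₂ τ S Equal
  equal-from-meets m = and₂ (sameStart-from-meets m) (sameEnd-from-meets m)

module _ {S : List IISym} where

  starts-reversed : ii03 ∈ S → Definable₂ reversal S Starts
  starts-reversed ∈S = atom₂ ii03 ∈S (λ O → finishes⇔reversed-starts)

  before-reversed : ii44 ∈ S → Definable₂ reversal S Before
  before-reversed ∈S = converse-atom₂ ii44 ∈S (λ O → before⇔reversed-before)

  overlaps-reversed : ii24 ∈ S → Definable₂ reversal S Overlaps
  overlaps-reversed ∈S = converse-atom₂ ii24 ∈S (λ O → overlaps⇔reversed-overlaps)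

  during-reversed : ii04 ∈ S → Definable₂ reversal S During
  during-reversed ∈S = atom₂ ii04 ∈S (λ O → during⇔reversed-during)

  meets-unreversed : Definable₂ reversal S Meets → Definable₂ identity S Meets
  meets-unreversed m = untranslate (swap₂ m) reversed-meets⇔meets

  sameEnd-from-finishes : ii03 ∈ S → Definable₂ identity S SameEnd
  sameEnd-from-finishes ∈S =
    untranslate (sameStart-from-starts (starts-reversed ∈S)) reversed-sameStart⇔sameEnd

  equal-from-finishes : ii03 ∈ S → Definable₂ identity S Equal
  equal-from-finishes ∈S = untranslate (equal-from-starts (starts-reversed ∈S)) reversed-equal⇔equal

private
  ∈-head : ∀ {x : IISym} {xs} → x ∈ x ∷ xs
  ∈-head = Any.here refl

  ∈-second : ∀ {x y : IISym} {xs} → y ∈ x ∷ y ∷ xs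
  ∈-second = Any.there ∈-head

meets-ii34 : Definable₂ identity (ii34 ∷ []) Meets
meets-ii34 = transport₂ (symbol ∈-head) (λ I J → ⇔-sym (meets⇔ii34 I J))

meets-ii14-ii24 : Definable₂ identity (ii14 ∷ ii24 ∷ []) Meets
meets-ii14-ii24 = meets-from-starts-overlaps (symbol ∈-head) (symbol ∈-second)

meets-ii03-ii24 : Definable₂ identity (ii03 ∷ ii24 ∷ []) Meets
meets-ii03-ii24 =
  meets-unreversed (meets-from-starts-overlaps (starts-reversed ∈-head) (overlaps-reversed ∈-second))

meets-ii14-ii03 : Definable₂ identity (ii14 ∷ ii03 ∷ []) Meets
meets-ii14-ii03 = meets-from-starts-sameEnd (symbol ∈-head) (sameEnd-from-finishes ∈-second)

meets-ii14-ii44 : Definable₂ identity (ii14 ∷ ii44 ∷ []) Meets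
meets-ii14-ii44 = meets-from-starts-before (symbol ∈-head) (symbol ∈-second)

meets-ii03-ii44 : Definable₂ identity (ii03 ∷ ii44 ∷ []) Meets
meets-ii03-ii44 =
  meets-unreversed (meets-from-starts-before (starts-reversed ∈-head) (before-reversed ∈-second))

meets-ii14-ii04 : Definable₂ identity (ii14 ∷ ii04 ∷ []) Meets
meets-ii14-ii04 = meets-from-starts-during (symbol ∈-head) (symbol ∈-second)

meets-ii03-ii04 : Definable₂ identity (ii03 ∷ ii04 ∷ []) Meets
meets-ii03-ii04 =
  meets-unreversed (meets-from-starts-during (starts-reversed ∈-head) (during-reversed ∈-second))

lemma3p1 :
    All (λ p → Defines (proj₁ p) (proj₂ p))
      ( (ii34 , ii14 ∷ ii24 ∷ [])
      ∷ (ii34 , ii03 ∷ ii24 ∷ [])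
      ∷ (ii34 , ii14 ∷ ii03 ∷ [])
      ∷ (ii34 , ii14 ∷ ii44 ∷ [])
      ∷ (ii34 , ii03 ∷ ii44 ∷ [])
      ∷ (ii34 , ii14 ∷ ii04 ∷ [])
      ∷ (ii34 , ii03 ∷ ii04 ∷ [])
      ∷ (ii14 , ii34 ∷ [])
      ∷ (ii14 , ii03 ∷ ii24 ∷ [])
      ∷ (ii14 , ii03 ∷ ii44 ∷ [])
      ∷ (ii14 , ii03 ∷ ii04 ∷ [])
      ∷ (ii24 , ii34 ∷ [])
      ∷ (ii24 , ii14 ∷ ii03 ∷ [])
      ∷ (ii24 , ii14 ∷ ii44 ∷ [])
      ∷ (ii24 , ii14 ∷ ii04 ∷ [])
      ∷ (ii24 , ii03 ∷ ii44 ∷ [])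
      ∷ (ii24 , ii03 ∷ ii04 ∷ [])
      ∷ (ii04 , ii34 ∷ [])
      ∷ (ii04 , ii14 ∷ ii24 ∷ [])
      ∷ (ii04 , ii14 ∷ ii03 ∷ [])
      ∷ (ii04 , ii14 ∷ ii44 ∷ [])
      ∷ (ii04 , ii03 ∷ ii24 ∷ [])
      ∷ (ii04 , ii03 ∷ ii44 ∷ [])
      ∷ (ii44 , ii34 ∷ [])
      ∷ (ii44 , ii14 ∷ ii24 ∷ [])
      ∷ (ii44 , ii14 ∷ ii03 ∷ [])
      ∷ (ii44 , ii14 ∷ ii04 ∷ [])
      ∷ (ii44 , ii03 ∷ ii24 ∷ [])
      ∷ (ii44 , ii03 ∷ ii04 ∷ [])
      ∷ (=i , ii34 ∷ [])
      ∷ (=i , ii14 ∷ [])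
      ∷ (=i , ii03 ∷ [])
      ∷ [] )
lemma3p1 =
    defines ii34 (ii34-from-meets meets-ii14-ii24) ∷ defines ii34 (ii34-from-meets meets-ii03-ii24)
  ∷ defines ii34 (ii34-from-meets meets-ii14-ii03) ∷ defines ii34 (ii34-from-meets meets-ii14-ii44)
  ∷ defines ii34 (ii34-from-meets meets-ii03-ii44) ∷ defines ii34 (ii34-from-meets meets-ii14-ii04)
  ∷ defines ii34 (ii34-from-meets meets-ii03-ii04)
  ∷ defines ii14 (starts-from-meets meets-ii34) ∷ defines ii14 (starts-from-meets meets-ii03-ii24)
  ∷ defines ii14 (starts-from-meets meets-ii03-ii44) ∷ defines ii14 (starts-from-meets meets-ii03-ii04)
  ∷ defines ii24 (overlaps-from-meets meets-ii34) ∷ defines ii24 (overlaps-from-meets meets-ii14-ii03)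
  ∷ defines ii24 (overlaps-from-meets meets-ii14-ii44) ∷ defines ii24 (overlaps-from-meets meets-ii14-ii04)
  ∷ defines ii24 (overlaps-from-meets meets-ii03-ii44) ∷ defines ii24 (overlaps-from-meets meets-ii03-ii04)
  ∷ defines ii04 (during-from-meets meets-ii34) ∷ defines ii04 (during-from-meets meets-ii14-ii24)
  ∷ defines ii04 (during-from-meets meets-ii14-ii03) ∷ defines ii04 (during-from-meets meets-ii14-ii44)
  ∷ defines ii04 (during-from-meets meets-ii03-ii24) ∷ defines ii04 (during-from-meets meets-ii03-ii44)
  ∷ defines ii44 (before-from-meets meets-ii34) ∷ defines ii44 (before-from-meets meets-ii14-ii24)
  ∷ defines ii44 (before-from-meets meets-ii14-ii03) ∷ defines ii44 (before-from-meets meets-ii14-ii04)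
  ∷ defines ii44 (before-from-meets meets-ii03-ii24) ∷ defines ii44 (before-from-meets meets-ii03-ii04)
  ∷ defines =i (equal-from-meets meets-ii34) ∷ defines =i (equal-from-starts (symbol ∈-head))
  ∷ defines =i (equal-from-finishes ∈-head)
  ∷ []
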